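{- Let $r$ be a positive integer and let $m_1, \dots, m_r$ be positive integers such that $\{\log_2 m_i\} \ge \{\log_2 3\}$ for every $i$, and $m_i \ge 4$ for at least $\lfloor r/2 \rfloor$ of the indices $i$. If $\sum_{i=1}^r \{\log_2 m_i\} < \lfloor r/2 \rfloor + 1$, then \[ \mathsf{D}_{\pm}\Big( \bigoplus_{i=1}^r C_{m_i} \Big) = \Big\lfloor \sum_{i=1}^r \log_2 m_i \Big\rfloor + 1. \]
   Context: $C_m$ denotes a cyclic group of order $m$; $\{x\} = x - \lfloor x\rfloor$ is the fractional part. For a finite abelian group $G$ (written additively), $\mathsf{D}_{\pm}(G)$ is the smallest positive integer $\ell$ such that for every sequence $g_1,\dots,g_k$ of elements of $G$ (repetitions allowed) with $k \ge \ell$ there exist a non-empty subset $I \subset \{1,\dots,k\}$ and $a_i \in \{+1,-1\}$ ($i\in I$) with $\sum_{i \in I} a_i g_i = 0$. -}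

module Defs where

open import Data.Nat using (ℕ; zero; suc; _+_; _*_; _^_; _≤_; _<_; _≤?_; ⌊_/2⌋)
open import Data.Nat.Logarithm using (⌊log₂_⌋)
open import Data.Fin using (Fin; zero; suc; toℕ)
open import Data.Integer as ℤ using (ℤ; +_; -[1+_])
open import Data.Integer.Divisibility using () renaming (_∣_ to _∣ℤ_)
open import Data.Product using (Σ; _×_; ∃)
open import Data.Sum using (_⊎_)
open import Relation.Binary.PropositionalEquality using (_≡_; _≢_)
open import Relation.Nullary.Decidable using (does)
open import Data.Bool using (if_then_else_)

∑ : (n : ℕ) → (Fin n → ℕ) → ℕ
∑ zero f = 0
∑ (suc n) f = f zero + ∑ n (λ i → f (suc i))

∏ : (n : ℕ) → (Fin n → ℕ) → ℕ
∏ zero f = 1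
∏ (suc n) f = f zero * ∏ n (λ i → f (suc i))

∑ℤ : (n : ℕ) → (Fin n → ℤ) → ℤ
∑ℤ zero f = + 0
∑ℤ (suc n) f = f zero ℤ.+ ∑ℤ n (λ i → f (suc i))

count≥4 : (r : ℕ) → (Fin r → ℕ) → ℕ
count≥4 r m = ∑ r (λ i → if does (4 ≤? m i) then 1 else 0)

-- elements of ⊕_{t<r} C_{m t}: a residue in Fin (m t) for each coordinate
Elem : (r : ℕ) → (Fin r → ℕ) → Set
Elem r m = (t : Fin r) → Fin (m t)

-- a coefficient is in {-1,0,+1}; 0 means the index is not in I
IsSign : ℤ → Set
IsSign c = (c ≡ + 0) ⊎ ((c ≡ + 1) ⊎ (c ≡ -[1+ 0 ]))

HasPMZeroSum : (r : ℕ) (m : Fin r → ℕ) (k : ℕ) → (Fin k → Elem r m) → Set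
HasPMZeroSum r m k g =
  Σ (Fin k → ℤ) λ c →
    ((j : Fin k) → IsSign (c j)) ×
    (∃ λ j → c j ≢ + 0) ×
    ((t : Fin r) → (+ m t) ∣ℤ ∑ℤ k (λ j → c j ℤ.* + toℕ (g j t)))

DpmProp : (r : ℕ) (m : Fin r → ℕ) (ℓ : ℕ) → Set
DpmProp r m ℓ = (k : ℕ) → ℓ ≤ k → (g : Fin k → Elem r m) → HasPMZeroSum r m k g

IsDpm : (r : ℕ) (m : Fin r → ℕ) (ℓ : ℕ) → Set
IsDpm r m ℓ = (1 ≤ ℓ) × DpmProp r m ℓ × ((ℓ' : ℕ) → 1 ≤ ℓ' → DpmProp r m ℓ' → ℓ ≤ ℓ')

-- {log₂ n} ≥ {log₂ 3}  ⇔  n / 2^⌊log₂ n⌋ ≥ 3/2  ⇔  3 · 2^⌊log₂ n⌋ ≤ 2 n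
FracLog≥FracLog3 : ℕ → Set
FracLog≥FracLog3 n = 3 * 2 ^ ⌊log₂ n ⌋ ≤ 2 * n

-- ∑ {log₂ m_i} < h + 1  ⇔  ∏ m_i < 2^(∑ ⌊log₂ m_i⌋ + h + 1)
SumFracLog< : (r : ℕ) → (Fin r → ℕ) → ℕ → Set
SumFracLog< r m h = ∏ r m < 2 ^ (∑ r (λ i → ⌊log₂ m i ⌋) + h + 1)

-- Upper bound: for k ≥ ⌊log₂ ∏ mᵢ⌋ + 1 the 2^k subset sums of a sequence g₁ … g_k cannot be
-- pairwise distinct in ⊕ C_(mᵢ), and the difference of two colliding subsets is a nonempty
-- ±1-weighted zero sum.
-- Lower bound: a coordinate C_a carries the powers 1, 2, …, 2^(⌊log₂ a⌋ - 1); a signed sum of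
-- these has absolute value below 2^⌊log₂ a⌋ ≤ a and vanishes only for the zero signs. A pair of
-- coordinates C_a ⊕ C_b with b ≥ 4 carries one element more, and {log₂ a}, {log₂ b} ≥ {log₂ 3},
-- i.e. 3 · 2^⌊log₂ a⌋ ≤ 2a, leaves exactly enough room for it. Pairing ⌊r/2⌋ disjoint couples of
-- coordinates gives a zero-sum free sequence of length ∑ ⌊log₂ mᵢ⌋ + ⌊r/2⌋, and the hypothesis
-- ∑ {log₂ mᵢ} < ⌊r/2⌋ + 1 says precisely that ⌊log₂ ∏ mᵢ⌋ ≤ ∑ ⌊log₂ mᵢ⌋ + ⌊r/2⌋.

module Submission where

open import Defs
open import Data.Nat using (ℕ; _+_; _≤_; _<_; ⌊_/2⌋)
open import Data.Nat.Logarithm using (⌊log₂_⌋)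
open import Data.Fin using (Fin)

open import Data.Nat
  using (zero; suc; _*_; _^_; _∸_; ⌈_/2⌉; z≤n; s≤s; z<s; NonZero; >-nonZero; _≤?_)
open import Data.Nat.Properties as ℕ
  using (≤-refl; ≤-trans; <-≤-trans; ≤-<-trans; ≰⇒>; <⇒≱; module ≤-Reasoning)
open import Data.Nat.Logarithm using (⌊log₂⌋-mono-≤; ⌊log₂[2^n]⌋≡n)
open import Data.Nat.Logarithm.Core using (⌊log2⌋)
open import Data.Nat.DivMod using (_mod_; _%_; _/_; m%n<n; m≡m%n+[m/n]*n)
open import Data.Fin
  using (zero; suc; toℕ; _↑ˡ_; _↑ʳ_; splitAt; join; punchIn; combine; finToFun; funToFin)
import Data.Fin.Properties as Fin
open import Data.Integer as ℤ using (ℤ; +_; -[1+_]; ∣_∣)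
import Data.Integer.Properties as ℤ
import Data.Integer.Tactic.RingSolver as ℤ
import Data.Nat.Tactic.RingSolver as ℕ
open import Data.Vec.Functional using (Vector; _++_; _∷_; []; insertAt)
open import Data.Vec.Functional.Properties using (insertAt-lookup; insertAt-punchIn)
import Data.Integer.Divisibility.Signed as ℤ
open import Data.Integer.Divisibility using () renaming (_∣_ to _∣ᵤ_)
import Data.Nat.Divisibility as ℕ
open import Data.Empty using (⊥-elim)
open import Data.Sum using (_⊎_; inj₁; inj₂; [_,_]′)
open import Data.Product using (Σ; ∃; _×_; _,_; proj₁; proj₂)
open import Relation.Nullary using (Dec; yes; no; ¬_; contradiction)
open import Relation.Nullary.Decidable using (does; dec-true; dec-false; _×-dec_; _⊎-dec_; from-yes)
open import Data.Bool using (if_then_else_)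
open import Algebra.Properties.AbelianGroup ℤ.+-0-abelianGroup using (inverseˡ-unique)
open import Function using (_∘_)
open import Induction.WellFounded using (acc)
open import Relation.Binary.PropositionalEquality
  using (_≡_; _≢_; _≗_; refl; sym; trans; cong; cong₂; subst; module ≡-Reasoning)

import Algebra.Properties.CommutativeMonoid.Sum ℕ.+-0-commutativeMonoid as ℕΣ
import Algebra.Properties.Semiring.Sum ℤ.+-*-semiring as ℤΣ
open ℤΣ using (sum; sum-cong-≗)

∑≡sum : ∀ n (f : Fin n → ℕ) → ∑ n f ≡ ℕΣ.sum f
∑≡sum zero    f = refl
∑≡sum (suc n) f = cong (_+_ (f zero)) (∑≡sum n (f ∘ suc))

∑ℤ≡sum : ∀ n (f : Fin n → ℤ) → ∑ℤ n f ≡ sum f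
∑ℤ≡sum zero    f = refl
∑ℤ≡sum (suc n) f = cong (ℤ._+_ (f zero)) (∑ℤ≡sum n (f ∘ suc))

∑-remove : ∀ {n} (f : Fin (suc n) → ℕ) j → ∑ (suc n) f ≡ f j + ∑ n (f ∘ punchIn j)
∑-remove {n} f j = begin
  ∑ (suc n) f                  ≡⟨ ∑≡sum (suc n) f ⟩
  ℕΣ.sum f                     ≡⟨ ℕΣ.sum-remove {i = j} f ⟩
  f j + ℕΣ.sum (f ∘ punchIn j) ≡⟨ cong (_+_ (f j)) (∑≡sum n (f ∘ punchIn j)) ⟨
  f j + ∑ n (f ∘ punchIn j)    ∎
  where open ≡-Reasoning

sum-↑ : ∀ m {n} (f : Vector ℤ (m + n)) → sum f ≡ sum (f ∘ (_↑ˡ n)) ℤ.+ sum (f ∘ (m ↑ʳ_))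
sum-↑ zero    f = sym (ℤ.+-identityˡ (sum f))
sum-↑ (suc m) {n} f = trans (cong (ℤ._+_ (f zero)) (sum-↑ m (f ∘ suc)))
  (sym (ℤ.+-assoc (f zero) (sum (f ∘ suc ∘ (_↑ˡ n))) (sum (f ∘ suc ∘ (m ↑ʳ_)))))

sum-zero : ∀ {n} (f : Vector ℤ n) → (∀ i → f i ≡ + 0) → sum f ≡ + 0
sum-zero {n} f f≗0 = trans (sum-cong-≗ f≗0) (ℤΣ.sum-replicate-zero n)

∑-distrib-- : ∀ {n} (f g : Vector ℤ n) → sum (λ i → f i ℤ.- g i) ≡ sum f ℤ.- sum g
∑-distrib-- {zero}  f g = refl
∑-distrib-- {suc n} f g = trans (cong (ℤ._+_ (f zero ℤ.- g zero)) (∑-distrib-- (f ∘ suc) (g ∘ suc)))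
  (shuffle (f zero) (g zero) (sum (f ∘ suc)) (sum (g ∘ suc)))
  where
  shuffle : ∀ a b x y → (a ℤ.- b) ℤ.+ (x ℤ.- y) ≡ (a ℤ.+ x) ℤ.- (b ℤ.+ y)
  shuffle = ℤ.solve-∀

pos-sum : ∀ {n} (f : Vector ℕ n) → + ℕΣ.sum f ≡ sum (+_ ∘ f)
pos-sum {zero}  f = refl
pos-sum {suc n} f = trans (ℤ.pos-+ (f zero) _) (cong (ℤ._+_ (+ f zero)) (pos-sum (f ∘ suc)))

∣-sum : ∀ {n d} (f : Vector ℤ n) → (∀ i → d ℤ.∣ f i) → d ℤ.∣ sum f
∣-sum {zero}  f _   = ℤ.divides (+ 0) refl
∣-sum {suc n} f d∣f = ℤ.∣m∣n⇒∣m+n (d∣f zero) (∣-sum (f ∘ suc) (d∣f ∘ suc))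

2*⌊n/2⌋≤n : ∀ n → 2 * ⌊ n /2⌋ ≤ n
2*⌊n/2⌋≤n n = begin
  ⌊ n /2⌋ + (⌊ n /2⌋ + 0) ≡⟨ cong (_+_ ⌊ n /2⌋) (ℕ.+-identityʳ _) ⟩
  ⌊ n /2⌋ + ⌊ n /2⌋       ≤⟨ ℕ.+-monoʳ-≤ ⌊ n /2⌋ (ℕ.⌊n/2⌋≤⌈n/2⌉ n) ⟩
  ⌊ n /2⌋ + ⌈ n /2⌉       ≡⟨ ℕ.⌊n/2⌋+⌈n/2⌉≡n n ⟩
  n                       ∎
  where open ≤-Reasoning

-- Stated for an arbitrary accessibility proof, so that the recursion defining ⌊log2⌋ unfolds.
2^⌊log2⌋≤n : ∀ n {rec} → 1 ≤ n → 2 ^ ⌊log2⌋ n rec ≤ n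
2^⌊log2⌋≤n 1                      _ = ≤-refl
2^⌊log2⌋≤n (suc (suc n)) {acc rs} _ = begin
  2 * 2 ^ ⌊log2⌋ (suc ⌊ n /2⌋) _  ≤⟨ ℕ.*-monoʳ-≤ 2 (2^⌊log2⌋≤n (suc ⌊ n /2⌋) z<s) ⟩
  2 * suc ⌊ n /2⌋                 ≡⟨ ℕ.*-suc 2 ⌊ n /2⌋ ⟩
  2 + 2 * ⌊ n /2⌋                 ≤⟨ ℕ.+-monoʳ-≤ 2 (2*⌊n/2⌋≤n n) ⟩
  2 + n                           ∎
  where open ≤-Reasoning

2^⌊log₂n⌋≤n : ∀ {n} → 1 ≤ n → 2 ^ ⌊log₂ n ⌋ ≤ n
2^⌊log₂n⌋≤n {n} = 2^⌊log2⌋≤n n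

n<2^[1+⌊log₂n⌋] : ∀ n → n < 2 ^ suc ⌊log₂ n ⌋
n<2^[1+⌊log₂n⌋] n = ≰⇒> λ 2^≤n →
  ℕ.n≮n ⌊log₂ n ⌋ (subst (_≤ ⌊log₂ n ⌋) (⌊log₂[2^n]⌋≡n _) (⌊log₂⌋-mono-≤ 2^≤n))

2^m<2^[1+n]⇒m≤n : ∀ {m n} → 2 ^ m < 2 ^ suc n → m ≤ n
2^m<2^[1+n]⇒m≤n 2^m<2^[1+n] = ℕ.≮⇒≥ λ n<m → <⇒≱ 2^m<2^[1+n] (ℕ.^-monoʳ-≤ 2 n<m)

∏-positive : ∀ r (m : Fin r → ℕ) → (∀ t → 1 ≤ m t) → 1 ≤ ∏ r m
∏-positive zero    m pos = ≤-refl
∏-positive (suc r) m pos = ℕ.*-mono-≤ (pos zero) (∏-positive r (m ∘ suc) (pos ∘ suc))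

Signs : ∀ {K} → Vector ℤ K → Set
Signs c = ∀ l → IsSign (c l)

combination : ∀ {K r} → Vector ℤ K → Vector (Fin r → ℕ) K → Fin r → ℤ
combination c v t = sum λ l → c l ℤ.* + v l t

combination-0 : ∀ {K r} c (v : Vector (Fin r → ℕ) K) t → (∀ l → v l t ≡ 0) → combination c v t ≡ + 0
combination-0 c v t v≡0 = sum-zero _ λ l → trans (cong (λ x → c l ℤ.* + x) (v≡0 l)) (ℤ.*-zeroʳ (c l))

++-↑ˡ : ∀ {A : Set} {m n} (u : Vector A m) (v : Vector A n) l → (u ++ v) (l ↑ˡ n) ≡ u l
++-↑ˡ {m = m} {n} u v l = cong [ u , v ]′ (Fin.splitAt-↑ˡ m l n)

++-↑ʳ : ∀ {A : Set} {m n} (u : Vector A m) (v : Vector A n) l → (u ++ v) (m ↑ʳ l) ≡ v l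
++-↑ʳ {m = m} {n} u v l = cong [ u , v ]′ (Fin.splitAt-↑ʳ m n l)

combination-++ : ∀ {K₁ K₂ r} c (u : Vector (Fin r → ℕ) K₁) (v : Vector (Fin r → ℕ) K₂) t →
  combination c (u ++ v) t ≡ combination (c ∘ (_↑ˡ K₂)) u t ℤ.+ combination (c ∘ (K₁ ↑ʳ_)) v t
combination-++ {K₁} {K₂} c u v t = trans (sum-↑ K₁ _) (cong₂ ℤ._+_
  (sum-cong-≗ λ l → cong (λ w → c (l ↑ˡ K₂) ℤ.* + w t) (++-↑ˡ u v l))
  (sum-cong-≗ λ l → cong (λ w → c (K₁ ↑ʳ l) ℤ.* + w t) (++-↑ʳ u v l)))

combination-distrib-- : ∀ {K r} (c₁ c₂ : Vector ℤ K) (v : Vector (Fin r → ℕ) K) t →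
  combination (λ l → c₁ l ℤ.- c₂ l) v t ≡ combination c₁ v t ℤ.- combination c₂ v t
combination-distrib-- {K} c₁ c₂ v t = trans (sum-cong-≗ {K} λ l → distrib (c₁ l) (c₂ l) (+ v l t))
  (∑-distrib-- (λ l → c₁ l ℤ.* + v l t) (λ l → c₂ l ℤ.* + v l t))
  where
  distrib : ∀ a b x → (a ℤ.- b) ℤ.* x ≡ a ℤ.* x ℤ.- b ℤ.* x
  distrib = ℤ.solve-∀

pos-combination : ∀ {K r} (a : Vector ℕ K) (v : Vector (Fin r → ℕ) K) t →
  combination (+_ ∘ a) v t ≡ + ℕΣ.sum (λ l → a l * v l t)
pos-combination {K} a v t =
  trans (sum-cong-≗ {K} λ l → sym (ℤ.pos-* (a l) (v l t))) (sym (pos-sum (λ l → a l * v l t)))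

-- Upper bound: colliding subset sums

reduce : ∀ {r} (m : Fin r → ℕ) → (∀ t → 1 ≤ m t) → (Fin r → ℕ) → Elem r m
reduce m pos w t = _mod_ (w t) (m t) {{>-nonZero (pos t)}}

representatives : ∀ {r K} {m : Fin r → ℕ} → Vector (Elem r m) K → Vector (Fin r → ℕ) K
representatives g l t = toℕ (g l t)

m∣x-[x%m] : ∀ x m .{{_ : NonZero m}} → + m ℤ.∣ + x ℤ.- + toℕ (x mod m)
m∣x-[x%m] x m = ℤ.divides (+ (x / m)) (begin
  + x ℤ.- + toℕ (x mod m)
    ≡⟨ cong (λ y → + x ℤ.- + y) (Fin.toℕ-fromℕ< (m%n<n x m)) ⟩
  + x ℤ.- + (x % m)
    ≡⟨ cong (λ y → + y ℤ.- + (x % m)) (m≡m%n+[m/n]*n x m) ⟩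
  + (x % m + x / m * m) ℤ.- + (x % m)
    ≡⟨ cong (ℤ._- + (x % m)) (ℤ.pos-+ (x % m) (x / m * m)) ⟩
  + (x % m) ℤ.+ + (x / m * m) ℤ.- + (x % m)
    ≡⟨ cong (λ y → + (x % m) ℤ.+ y ℤ.- + (x % m)) (ℤ.pos-* (x / m) m) ⟩
  + (x % m) ℤ.+ + (x / m) ℤ.* + m ℤ.- + (x % m)
    ≡⟨ cancel (+ (x % m)) (+ (x / m) ℤ.* + m) ⟩
  + (x / m) ℤ.* + m ∎)
  where
  open ≡-Reasoning
  cancel : ∀ a b → a ℤ.+ b ℤ.- a ≡ b
  cancel = ℤ.solve-∀

mod≡⇒m∣x-y : ∀ x y m .{{_ : NonZero m}} → x mod m ≡ y mod m → + m ℤ.∣ + x ℤ.- + y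
mod≡⇒m∣x-y x y m x≡y = subst (+ m ℤ.∣_)
  (trans (cong (λ z → (+ x ℤ.- z) ℤ.- (+ y ℤ.- + toℕ (y mod m))) (cong (λ z → + toℕ z) x≡y))
         (cancel (+ x) (+ y) (+ toℕ (y mod m))))
  (ℤ.∣m∣n⇒∣m-n (m∣x-[x%m] x m) (m∣x-[x%m] y m))
  where
  cancel : ∀ a b c → (a ℤ.- c) ℤ.- (b ℤ.- c) ≡ a ℤ.- b
  cancel = ℤ.solve-∀

encode : ∀ r (m : Fin r → ℕ) → Elem r m → Fin (∏ r m)
encode zero    m e = zero
encode (suc r) m e = combine (e zero) (encode r (m ∘ suc) (e ∘ suc))

encode-injective : ∀ r (m : Fin r → ℕ) (e e′ : Elem r m) →
  encode r m e ≡ encode r m e′ → ∀ t → e t ≡ e′ t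
encode-injective (suc r) m e e′ eq = λ where
    zero    → proj₁ heads-and-tails
    (suc t) → encode-injective r (m ∘ suc) (e ∘ suc) (e′ ∘ suc) (proj₂ heads-and-tails) t
  where
  heads-and-tails : e zero ≡ e′ zero × encode r (m ∘ suc) (e ∘ suc) ≡ encode r (m ∘ suc) (e′ ∘ suc)
  heads-and-tails = Fin.combine-injective (e zero) (encode r (m ∘ suc) (e ∘ suc))
                                          (e′ zero) (encode r (m ∘ suc) (e′ ∘ suc)) eq

funToFin-cong : ∀ {m n} {f g : Fin m → Fin n} → f ≗ g → funToFin f ≡ funToFin g
funToFin-cong {zero}  _   = refl
funToFin-cong {suc m} f≗g = cong₂ combine (f≗g zero) (funToFin-cong (f≗g ∘ suc))

bit-difference-sign : ∀ (x y : Fin 2) → IsSign (+ toℕ x ℤ.- + toℕ y)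
bit-difference-sign zero       zero       = inj₁ refl
bit-difference-sign zero       (suc zero) = inj₂ (inj₂ refl)
bit-difference-sign (suc zero) zero       = inj₂ (inj₁ refl)
bit-difference-sign (suc zero) (suc zero) = inj₁ refl

bit-difference-nonzero : ∀ {x y : Fin 2} → x ≢ y → + toℕ x ℤ.- + toℕ y ≢ + 0
bit-difference-nonzero {zero}     {zero}     x≢y _ = x≢y refl
bit-difference-nonzero {suc zero} {suc zero} x≢y _ = x≢y refl

-- A subset of Fin k is an element of Fin (2 ^ k), read as its indicator function by finToFun.
subsetSum : ∀ {r k} {m : Fin r → ℕ} → (Fin k → Elem r m) → Fin (2 ^ k) → Fin r → ℕ
subsetSum {k = k} g s t = ℕΣ.sum λ l → toℕ (finToFun {2} {k} s l) * toℕ (g l t)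

distinct-subsets⇒HasPMZeroSum : ∀ {r k} (m : Fin r → ℕ) (pos : ∀ t → 1 ≤ m t) (g : Fin k → Elem r m)
  {s s′ : Fin (2 ^ k)} → s ≢ s′ →
  (∀ t → reduce m pos (subsetSum g s) t ≡ reduce m pos (subsetSum g s′) t) →
  HasPMZeroSum r m k g
distinct-subsets⇒HasPMZeroSum {k = k} m pos g {s} {s′} s≢s′ same-residues =
  c , (λ l → bit-difference-sign (bits s l) (bits s′ l)) ,
  (proj₁ differing-bit , bit-difference-nonzero (proj₂ differing-bit)) , m∣∑
  where
  bits : Fin (2 ^ k) → Fin k → Fin 2
  bits = finToFun
  c : Vector ℤ k
  c l = + toℕ (bits s l) ℤ.- + toℕ (bits s′ l)
  differing-bit : ∃ λ l → bits s l ≢ bits s′ l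
  differing-bit = Fin.¬∀⟶∃¬ k _ (λ l → bits s l Fin.≟ bits s′ l) λ same →
    s≢s′ (trans (sym (Fin.funToFin-finToFin {k} {2} s))
      (trans (funToFin-cong same) (Fin.funToFin-finToFin {k} {2} s′)))
  m∣∑ : ∀ t → + m t ∣ᵤ ∑ℤ k (λ j → c j ℤ.* + toℕ (g j t))
  m∣∑ t = ℤ.∣⇒∣ᵤ (subst (+ m t ℤ.∣_) (sym ∑≡difference)
    (mod≡⇒m∣x-y (subsetSum g s t) (subsetSum g s′ t) (m t) {{>-nonZero (pos t)}} (same-residues t)))
    where
    open ≡-Reasoning
    ∑≡difference : ∑ℤ k (λ j → c j ℤ.* + toℕ (g j t)) ≡ + subsetSum g s t ℤ.- + subsetSum g s′ t
    ∑≡difference = begin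
      ∑ℤ k (λ j → c j ℤ.* + toℕ (g j t))
        ≡⟨ ∑ℤ≡sum k _ ⟩
      combination c (representatives g) t
        ≡⟨ combination-distrib-- (λ j → + toℕ (bits s j)) (λ j → + toℕ (bits s′ j))
             (representatives g) t ⟩
      combination (λ j → + toℕ (bits s j)) (representatives g) t ℤ.-
      combination (λ j → + toℕ (bits s′ j)) (representatives g) t
        ≡⟨ cong₂ ℤ._-_ (pos-combination (toℕ ∘ bits s) (representatives g) t)
                        (pos-combination (toℕ ∘ bits s′) (representatives g) t) ⟩
      + subsetSum g s t ℤ.- + subsetSum g s′ t ∎

∏<2^k⇒HasPMZeroSum : ∀ r (m : Fin r → ℕ) → (∀ t → 1 ≤ m t) → ∀ k → ∏ r m < 2 ^ k →
  (g : Fin k → Elem r m) → HasPMZeroSum r m k g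
∏<2^k⇒HasPMZeroSum r m pos k ∏<2^k g
  with s , s′ , s<s′ , same-code ← Fin.pigeonhole ∏<2^k (encode r m ∘ reduce m pos ∘ subsetSum g)
  = distinct-subsets⇒HasPMZeroSum m pos g (Fin.<⇒≢ s<s′) (encode-injective r m _ _ same-code)

-- Plus-minus zero-sum free sequences

ZeroSumFree : ∀ {r K} → (Fin r → ℕ) → Vector (Fin r → ℕ) K → Set
ZeroSumFree m v = ∀ c → Signs c → (∀ t → + m t ℤ.∣ combination c v t) → ∀ l → c l ≡ + 0

ZeroSumFreeSequence : ∀ {r} → (Fin r → ℕ) → ℕ → Set
ZeroSumFreeSequence {r} m K = Σ (Vector (Fin r → ℕ) K) (ZeroSumFree m)

combination-reduce-congruent : ∀ {r K} (m : Fin r → ℕ) (pos : ∀ t → 1 ≤ m t) c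
  (v : Vector (Fin r → ℕ) K) t →
  + m t ℤ.∣ combination c v t ℤ.- combination c (representatives (reduce m pos ∘ v)) t
combination-reduce-congruent {K = K} m pos c v t =
  subst (+ m t ℤ.∣_) (∑-distrib-- term reducedTerm) (∣-sum (λ j → term j ℤ.- reducedTerm j) λ j →
    subst (+ m t ℤ.∣_) (distrib (c j) (+ v j t) _)
      (ℤ.∣n⇒∣m*n (c j) (m∣x-[x%m] (v j t) (m t) {{>-nonZero (pos t)}})))
  where
  term reducedTerm : Vector ℤ K
  term j = c j ℤ.* + v j t
  reducedTerm j = c j ℤ.* + toℕ (reduce m pos (v j) t)
  distrib : ∀ a x y → a ℤ.* (x ℤ.- y) ≡ a ℤ.* x ℤ.- a ℤ.* y
  distrib = ℤ.solve-∀

zeroSumFree⇒¬HasPMZeroSum : ∀ {r K} (m : Fin r → ℕ) (pos : ∀ t → 1 ≤ m t)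
  (v : Vector (Fin r → ℕ) K) → ZeroSumFree m v → ¬ HasPMZeroSum r m K (reduce m pos ∘ v)
zeroSumFree⇒¬HasPMZeroSum {K = K} m pos v free (c , signs , (l , cₗ≢0) , m∣∑) =
  cₗ≢0 (free c signs m∣combination l)
  where
  m∣combination : ∀ t → + m t ℤ.∣ combination c v t
  m∣combination t = ℤ.∣m+n∣n⇒∣m (combination-reduce-congruent m pos c v t)
    (ℤ.∣m⇒∣-m (subst (+ m t ℤ.∣_) (∑ℤ≡sum K _) (ℤ.∣ᵤ⇒∣ (m∣∑ t))))

≡0-↑ : ∀ {m n} (c : Vector ℤ (m + n)) →
  (∀ l → c (l ↑ˡ n) ≡ + 0) → (∀ l → c (m ↑ʳ l) ≡ + 0) → ∀ l → c l ≡ + 0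
≡0-↑ {m} {n} c c↑ˡ≡0 c↑ʳ≡0 l =
  subst (λ k → c k ≡ + 0) (Fin.join-splitAt m n l) (onSplit (splitAt m l))
  where
  onSplit : ∀ s → c (join m n s) ≡ + 0
  onSplit (inj₁ l) = c↑ˡ≡0 l
  onSplit (inj₂ l) = c↑ʳ≡0 l

-- The laws force ι₁ and ι₂ to have disjoint images; they need not cover Fin r.
record CoordinateSplit (r d n : ℕ) : Set where
  field
    glue    : (Fin d → ℕ) → (Fin n → ℕ) → Fin r → ℕ
    ι₁      : Fin d → Fin r
    ι₂      : Fin n → Fin r
    glue-ι₁ : ∀ w z s → glue w z (ι₁ s) ≡ w s
    glue-ι₂ : ∀ w z s → glue w z (ι₂ s) ≡ z s

module _ {r d n} (S : CoordinateSplit r d n) where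
  open CoordinateSplit S

  merge : ∀ {K₁ K₂} → Vector (Fin d → ℕ) K₁ → Vector (Fin n → ℕ) K₂ → Vector (Fin r → ℕ) (K₁ + K₂)
  merge u v l = glue ((u ++ (λ _ _ → 0)) l) (((λ _ _ → 0) ++ v) l)

  combination-merge-ι₁ : ∀ {K₁ K₂} c (u : Vector (Fin d → ℕ) K₁) (v : Vector (Fin n → ℕ) K₂) s →
    combination c (merge u v) (ι₁ s) ≡ combination (c ∘ (_↑ˡ K₂)) u s
  combination-merge-ι₁ {K₁} {K₂} c u v s = begin
    combination c (merge u v) (ι₁ s)
      ≡⟨ sum-cong-≗ (λ l → cong (λ x → c l ℤ.* + x) (glue-ι₁ _ _ s)) ⟩
    combination c (u ++ (λ _ _ → 0)) s
      ≡⟨ combination-++ c u _ s ⟩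
    combination (c ∘ (_↑ˡ K₂)) u s ℤ.+ combination (c ∘ (K₁ ↑ʳ_)) (λ _ _ → 0) s
      ≡⟨ cong (ℤ._+_ (combination (c ∘ (_↑ˡ K₂)) u s))
           (combination-0 (c ∘ (K₁ ↑ʳ_)) (λ _ _ → 0) s λ _ → refl) ⟩
    combination (c ∘ (_↑ˡ K₂)) u s ℤ.+ + 0
      ≡⟨ ℤ.+-identityʳ _ ⟩
    combination (c ∘ (_↑ˡ K₂)) u s ∎
    where open ≡-Reasoning

  combination-merge-ι₂ : ∀ {K₁ K₂} c (u : Vector (Fin d → ℕ) K₁) (v : Vector (Fin n → ℕ) K₂) s →
    combination c (merge u v) (ι₂ s) ≡ combination (c ∘ (K₁ ↑ʳ_)) v s
  combination-merge-ι₂ {K₁} {K₂} c u v s = begin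
    combination c (merge u v) (ι₂ s)
      ≡⟨ sum-cong-≗ (λ l → cong (λ x → c l ℤ.* + x) (glue-ι₂ _ _ s)) ⟩
    combination c ((λ _ _ → 0) ++ v) s
      ≡⟨ combination-++ c _ v s ⟩
    combination (c ∘ (_↑ˡ K₂)) (λ _ _ → 0) s ℤ.+ combination (c ∘ (K₁ ↑ʳ_)) v s
      ≡⟨ cong (ℤ._+ combination (c ∘ (K₁ ↑ʳ_)) v s)
           (combination-0 (c ∘ (_↑ˡ K₂)) (λ _ _ → 0) s λ _ → refl) ⟩
    + 0 ℤ.+ combination (c ∘ (K₁ ↑ʳ_)) v s
      ≡⟨ ℤ.+-identityˡ _ ⟩
    combination (c ∘ (K₁ ↑ʳ_)) v s ∎
    where open ≡-Reasoning

  merge-zeroSumFree : ∀ {m : Fin r → ℕ} {K₁ K₂} →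
    ZeroSumFreeSequence (m ∘ ι₁) K₁ → ZeroSumFreeSequence (m ∘ ι₂) K₂ →
    ZeroSumFreeSequence m (K₁ + K₂)
  merge-zeroSumFree {m} {K₁} {K₂} (u , u-free) (v , v-free) = merge u v , free
    where
    free : ZeroSumFree m (merge u v)
    free c signs divides = ≡0-↑ c
      (u-free (c ∘ (_↑ˡ K₂)) (signs ∘ (_↑ˡ K₂))
        λ s → subst (+ m (ι₁ s) ℤ.∣_) (combination-merge-ι₁ c u v s) (divides (ι₁ s)))
      (v-free (c ∘ (K₁ ↑ʳ_)) (signs ∘ (K₁ ↑ʳ_))
        λ s → subst (+ m (ι₂ s) ℤ.∣_) (combination-merge-ι₂ c u v s) (divides (ι₂ s)))

single : ∀ {n} → Fin (suc n) → CoordinateSplit (suc n) 1 n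
single j = record
  { glue    = λ w z → insertAt z j (w zero)
  ; ι₁      = λ _ → j
  ; ι₂      = punchIn j
  ; glue-ι₁ = λ { w z zero → insertAt-lookup z j (w zero) }
  ; glue-ι₂ = λ w z → insertAt-punchIn z j (w zero)
  }

pair : ∀ {n} → Fin (suc (suc n)) → Fin (suc n) → CoordinateSplit (suc (suc n)) 2 n
pair j i = record
  { glue    = λ w z → insertAt (insertAt z i (w zero)) j (w (suc zero))
  ; ι₁      = punchIn j i ∷ j ∷ []
  ; ι₂      = punchIn j ∘ punchIn i
  ; glue-ι₁ = λ where
      w z zero       → trans (insertAt-punchIn _ j _ i) (insertAt-lookup z i _)
      w z (suc zero) → insertAt-lookup _ j _
  ; glue-ι₂ = λ w z s → trans (insertAt-punchIn _ j _ (punchIn i s)) (insertAt-punchIn z i _ s)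
  }

-- Binary expansions in one coordinate

∣sign∣≤1 : ∀ {e} → IsSign e → ∣ e ∣ ≤ 1
∣sign∣≤1 (inj₁ refl)        = z≤n
∣sign∣≤1 (inj₂ (inj₁ refl)) = s≤s z≤n
∣sign∣≤1 (inj₂ (inj₂ refl)) = s≤s z≤n

small-multiple≡0 : ∀ {n z} → + n ℤ.∣ z → ∣ z ∣ < n → z ≡ + 0
small-multiple≡0 {n} {z} n∣z ∣z∣<n with ∣ z ∣ in ∣z∣≡
... | zero  = ℤ.∣i∣≡0⇒i≡0 ∣z∣≡
... | suc _ = contradiction (subst (n ℕ.∣_) ∣z∣≡ (ℤ.∣⇒∣ᵤ n∣z)) (ℕ.>⇒∤ ∣z∣<n)

binary : ∀ {k} → Vector ℤ k → ℤ
binary c = sum λ l → c l ℤ.* + 2 ^ toℕ l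

binary-suc : ∀ {k} (c : Vector ℤ (suc k)) → binary c ≡ c zero ℤ.+ + 2 ℤ.* binary (c ∘ suc)
binary-suc {k} c = cong₂ ℤ._+_ (ℤ.*-identityʳ (c zero)) (begin
  sum (λ l → c (suc l) ℤ.* + (2 * 2 ^ toℕ l))
    ≡⟨ sum-cong-≗ {k} (λ l → trans (cong (c (suc l) ℤ.*_) (ℤ.pos-* 2 (2 ^ toℕ l)))
                                   (swap (c (suc l)) (+ 2 ^ toℕ l))) ⟩
  sum (λ l → + 2 ℤ.* (c (suc l) ℤ.* + 2 ^ toℕ l))
    ≡⟨ ℤΣ.*-distribˡ-sum (+ 2) (λ l → c (suc l) ℤ.* + 2 ^ toℕ l) ⟨
  + 2 ℤ.* binary (c ∘ suc) ∎)
  where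
  open ≡-Reasoning
  swap : ∀ x y → x ℤ.* (+ 2 ℤ.* y) ≡ + 2 ℤ.* (x ℤ.* y)
  swap = ℤ.solve-∀

∣binary∣<2^k : ∀ {k} (c : Vector ℤ k) → Signs c → ∣ binary c ∣ < 2 ^ k
∣binary∣<2^k {zero}  c signs = z<s
∣binary∣<2^k {suc k} c signs = begin-strict
  ∣ binary c ∣                     ≡⟨ cong ∣_∣ (binary-suc c) ⟩
  ∣ c zero ℤ.+ + 2 ℤ.* b ∣         ≤⟨ ℤ.∣i+j∣≤∣i∣+∣j∣ (c zero) _ ⟩
  (∣ c zero ∣) + (∣ + 2 ℤ.* b ∣)   ≡⟨ cong (_+_ ∣ c zero ∣) (ℤ.abs-* (+ 2) b) ⟩
  (∣ c zero ∣) + 2 * (∣ b ∣)       ≤⟨ ℕ.+-monoˡ-≤ (2 * ∣ b ∣) (∣sign∣≤1 (signs zero)) ⟩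
  1 + 2 * (∣ b ∣)                  <⟨ ℕ.n<1+n _ ⟩
  2 + 2 * (∣ b ∣)                  ≡⟨ ℕ.*-suc 2 ∣ b ∣ ⟨
  2 * suc (∣ b ∣)                  ≤⟨ ℕ.*-monoʳ-≤ 2 (∣binary∣<2^k (c ∘ suc) (signs ∘ suc)) ⟩
  2 * 2 ^ k                        ∎
  where
  open ≤-Reasoning
  b : ℤ
  b = binary (c ∘ suc)

binary≡0⇒≡0 : ∀ {k} (c : Vector ℤ k) → Signs c → binary c ≡ + 0 → ∀ l → c l ≡ + 0
binary≡0⇒≡0 {suc k} c signs binary≡0 = λ where
    zero    → c₀≡0
    (suc l) → binary≡0⇒≡0 (c ∘ suc) (signs ∘ suc) b≡0 l
  where
  b : ℤ
  b = binary (c ∘ suc)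
  c₀≡-2b : c zero ≡ ℤ.- (+ 2 ℤ.* b)
  c₀≡-2b = inverseˡ-unique (c zero) (+ 2 ℤ.* b) (trans (sym (binary-suc c)) binary≡0)
  2∣b∣≤1 : 2 * ∣ b ∣ ≤ 1
  2∣b∣≤1 = subst (_≤ 1)
    (trans (cong ∣_∣ c₀≡-2b) (trans (ℤ.∣-i∣≡∣i∣ (+ 2 ℤ.* b)) (ℤ.abs-* (+ 2) b)))
    (∣sign∣≤1 (signs zero))
  b≡0 : b ≡ + 0
  b≡0 = ℤ.∣i∣≡0⇒i≡0 (ℕ.n<1⇒n≡0 (ℕ.*-cancelˡ-< 2 ∣ b ∣ 1 (s≤s 2∣b∣≤1)))
  c₀≡0 : c zero ≡ + 0
  c₀≡0 = trans c₀≡-2b (cong (λ x → ℤ.- (+ 2 ℤ.* x)) b≡0)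

powers-zeroSumFree : ∀ {k} (m : Fin 1 → ℕ) → 2 ^ k ≤ m zero →
  ZeroSumFree m (λ (l : Fin k) _ → 2 ^ toℕ l)
powers-zeroSumFree m 2^k≤m c signs divides =
  binary≡0⇒≡0 c signs (small-multiple≡0 (divides zero) (<-≤-trans (∣binary∣<2^k c signs) 2^k≤m))

powers-sequence : (m : Fin 1 → ℕ) → 1 ≤ m zero → ZeroSumFreeSequence m ⌊log₂ m zero ⌋
powers-sequence m 1≤m = _ , powers-zeroSumFree m (2^⌊log₂n⌋≤n 1≤m)

-- In C_a ⊕ C_b, with X = 2^p and Y = 2^q: the elements (2^i, 0) for i < p, (0, 2^i) for i ≤ q,
-- and (X, Y), (X, 3Y), (X, -Y), where b ∸ Y represents -Y.
powers₁ : ∀ p → Vector (Fin 2 → ℕ) p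
powers₁ p l = 2 ^ toℕ l ∷ 0 ∷ []

powers₂ : ∀ q → Vector (Fin 2 → ℕ) q
powers₂ q l = 0 ∷ 2 ^ toℕ l ∷ []

pairExtras : (b p q : ℕ) → Vector (Fin 2 → ℕ) 3
pairExtras b p q =
  (2 ^ p ∷ 2 ^ q ∷ []) ∷ (2 ^ p ∷ 3 * 2 ^ q ∷ []) ∷ (2 ^ p ∷ b ∸ 2 ^ q ∷ []) ∷ []

pairBlock : (b p q : ℕ) → Vector (Fin 2 → ℕ) (p + (suc q + 3))
pairBlock b p q = powers₁ p ++ powers₂ (suc q) ++ pairExtras b p q

xWeight yWeight : ℤ → ℤ → ℤ → ℤ
xWeight e₁ e₂ e₃ = e₁ ℤ.+ e₂ ℤ.+ e₃
yWeight e₁ e₂ e₃ = e₁ ℤ.+ + 3 ℤ.* e₂ ℤ.- e₃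

module PairBlock (b p q : ℕ) (c : Vector ℤ (p + (suc q + 3))) where
  cA : Vector ℤ p
  cA = c ∘ (_↑ˡ (suc q + 3))
  c′ : Vector ℤ (suc q + 3)
  c′ = c ∘ (p ↑ʳ_)
  cB : Vector ℤ (suc q)
  cB = c′ ∘ (_↑ˡ 3)
  e₁ e₂ e₃ : ℤ
  e₁ = c′ (suc q ↑ʳ zero)
  e₂ = c′ (suc q ↑ʳ suc zero)
  e₃ = c′ (suc q ↑ʳ suc (suc zero))

  combination-first : combination c (pairBlock b p q) zero ≡ binary cA ℤ.+ + 2 ^ p ℤ.* xWeight e₁ e₂ e₃
  combination-first = begin
    combination c (pairBlock b p q) zero
      ≡⟨ combination-++ c (powers₁ p) _ zero ⟩
    binary cA ℤ.+ combination c′ (powers₂ (suc q) ++ pairExtras b p q) zero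
      ≡⟨ cong (ℤ._+_ (binary cA)) (combination-++ c′ (powers₂ (suc q)) (pairExtras b p q) zero) ⟩
    binary cA ℤ.+ (combination cB (powers₂ (suc q)) zero ℤ.+ (e₁ ℤ.* X ℤ.+ (e₂ ℤ.* X ℤ.+ (e₃ ℤ.* X ℤ.+ + 0))))
      ≡⟨ cong (λ z → binary cA ℤ.+ (z ℤ.+ (e₁ ℤ.* X ℤ.+ (e₂ ℤ.* X ℤ.+ (e₃ ℤ.* X ℤ.+ + 0)))))
           (combination-0 cB (powers₂ (suc q)) zero λ _ → refl) ⟩
    binary cA ℤ.+ (+ 0 ℤ.+ (e₁ ℤ.* X ℤ.+ (e₂ ℤ.* X ℤ.+ (e₃ ℤ.* X ℤ.+ + 0))))
      ≡⟨ collect (binary cA) X e₁ e₂ e₃ ⟩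
    binary cA ℤ.+ X ℤ.* xWeight e₁ e₂ e₃ ∎
    where
    open ≡-Reasoning
    X : ℤ
    X = + 2 ^ p
    collect : ∀ A X e₁ e₂ e₃ →
      A ℤ.+ (+ 0 ℤ.+ (e₁ ℤ.* X ℤ.+ (e₂ ℤ.* X ℤ.+ (e₃ ℤ.* X ℤ.+ + 0)))) ≡ A ℤ.+ X ℤ.* (e₁ ℤ.+ e₂ ℤ.+ e₃)
    collect = ℤ.solve-∀

  combination-second : 2 ^ q ≤ b → combination c (pairBlock b p q) (suc zero) ≡
    binary cB ℤ.+ + 2 ^ q ℤ.* yWeight e₁ e₂ e₃ ℤ.+ e₃ ℤ.* + b
  combination-second Y≤b = begin
    combination c (pairBlock b p q) (suc zero)
      ≡⟨ combination-++ c (powers₁ p) _ (suc zero) ⟩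
    combination cA (powers₁ p) (suc zero) ℤ.+
    combination c′ (powers₂ (suc q) ++ pairExtras b p q) (suc zero)
      ≡⟨ cong₂ ℤ._+_ (combination-0 cA (powers₁ p) (suc zero) λ _ → refl)
           (combination-++ c′ (powers₂ (suc q)) (pairExtras b p q) (suc zero)) ⟩
    + 0 ℤ.+ (binary cB ℤ.+ (e₁ ℤ.* Y ℤ.+ (e₂ ℤ.* + (3 * 2 ^ q) ℤ.+ (e₃ ℤ.* + (b ∸ 2 ^ q) ℤ.+ + 0))))
      ≡⟨ cong₂ (λ u v → + 0 ℤ.+ (binary cB ℤ.+ (e₁ ℤ.* Y ℤ.+ (e₂ ℤ.* u ℤ.+ (e₃ ℤ.* v ℤ.+ + 0)))))
           (ℤ.pos-* 3 (2 ^ q)) (trans (sym (ℤ.⊖-≥ Y≤b)) (sym (ℤ.[+m]-[+n]≡m⊖n b (2 ^ q)))) ⟩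
    + 0 ℤ.+ (binary cB ℤ.+ (e₁ ℤ.* Y ℤ.+ (e₂ ℤ.* (+ 3 ℤ.* Y) ℤ.+ (e₃ ℤ.* (+ b ℤ.- Y) ℤ.+ + 0))))
      ≡⟨ collect (binary cB) Y (+ b) e₁ e₂ e₃ ⟩
    binary cB ℤ.+ Y ℤ.* yWeight e₁ e₂ e₃ ℤ.+ e₃ ℤ.* + b ∎
    where
    open ≡-Reasoning
    Y : ℤ
    Y = + 2 ^ q
    collect : ∀ B Y b e₁ e₂ e₃ →
      + 0 ℤ.+ (B ℤ.+ (e₁ ℤ.* Y ℤ.+ (e₂ ℤ.* (+ 3 ℤ.* Y) ℤ.+ (e₃ ℤ.* (b ℤ.- Y) ℤ.+ + 0)))) ≡
      B ℤ.+ Y ℤ.* (e₁ ℤ.+ + 3 ℤ.* e₂ ℤ.- e₃) ℤ.+ e₃ ℤ.* b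
    collect = ℤ.solve-∀

ExtraSigns : ℤ → ℤ → ℤ → Set
ExtraSigns e₁ e₂ e₃ =
  (e₁ ≡ + 0 × e₂ ≡ + 0 × e₃ ≡ + 0) ⊎
  (1 ≤ ∣ xWeight e₁ e₂ e₃ ∣ × ∣ xWeight e₁ e₂ e₃ ∣ ≤ 2) ⊎
  (2 ≤ ∣ yWeight e₁ e₂ e₃ ∣ × ∣ yWeight e₁ e₂ e₃ ∣ ≤ 4)

extraSigns? : ∀ e₁ e₂ e₃ → Dec (ExtraSigns e₁ e₂ e₃)
extraSigns? e₁ e₂ e₃ =
  (e₁ ℤ.≟ + 0 ×-dec e₂ ℤ.≟ + 0 ×-dec e₃ ℤ.≟ + 0) ⊎-dec
  (1 ≤? ∣ xWeight e₁ e₂ e₃ ∣ ×-dec ∣ xWeight e₁ e₂ e₃ ∣ ≤? 2) ⊎-dec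
  (2 ≤? ∣ yWeight e₁ e₂ e₃ ∣ ×-dec ∣ yWeight e₁ e₂ e₃ ∣ ≤? 4)

sign : Vector ℤ 3
sign = + 0 ∷ + 1 ∷ -[1+ 0 ] ∷ []

sign-index : ∀ {e} → IsSign e → Σ (Fin 3) λ i → sign i ≡ e
sign-index (inj₁ refl)        = zero , refl
sign-index (inj₂ (inj₁ refl)) = suc zero , refl
sign-index (inj₂ (inj₂ refl)) = suc (suc zero) , refl

extraSigns : ∀ {e₁ e₂ e₃} → IsSign e₁ → IsSign e₂ → IsSign e₃ → ExtraSigns e₁ e₂ e₃
extraSigns s₁ s₂ s₃ with sign-index s₁ | sign-index s₂ | sign-index s₃
... | i , refl | j , refl | k , refl =
  from-yes (Fin.all? λ x → Fin.all? λ y → Fin.all? λ z → extraSigns? (sign x) (sign y) (sign z)) i j k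

n∤A+V*E : ∀ {n U} A V E → ∣ A ∣ < U → U ≤ V * ∣ E ∣ → U + V * ∣ E ∣ ≤ n →
  ¬ (+ n ℤ.∣ A ℤ.+ + V ℤ.* E)
n∤A+V*E {n} {U} A V E ∣A∣<U U≤V∣E∣ U+V∣E∣≤n n∣ =
  <⇒≱ ∣A∣<U (subst (U ≤_) (sym ∣A∣≡V∣E∣) U≤V∣E∣)
  where
  open ≤-Reasoning
  small : ∣ A ℤ.+ + V ℤ.* E ∣ < n
  small = begin-strict
    ∣ A ℤ.+ + V ℤ.* E ∣      ≤⟨ ℤ.∣i+j∣≤∣i∣+∣j∣ A _ ⟩
    (∣ A ∣) + (∣ + V ℤ.* E ∣) ≡⟨ cong (_+_ ∣ A ∣) (ℤ.abs-* (+ V) E) ⟩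
    (∣ A ∣) + V * (∣ E ∣)     <⟨ ℕ.+-monoˡ-< _ ∣A∣<U ⟩
    U + V * (∣ E ∣)           ≤⟨ U+V∣E∣≤n ⟩
    n                         ∎
  ∣A∣≡V∣E∣ : ∣ A ∣ ≡ V * ∣ E ∣
  ∣A∣≡V∣E∣ = trans (cong ∣_∣ (inverseˡ-unique A _ (small-multiple≡0 n∣ small)))
    (trans (ℤ.∣-i∣≡∣i∣ (+ V ℤ.* E)) (ℤ.abs-* (+ V) E))

xWeight≡0 : ∀ {e₁ e₂ e₃} → e₁ ≡ + 0 × e₂ ≡ + 0 × e₃ ≡ + 0 → xWeight e₁ e₂ e₃ ≡ + 0
xWeight≡0 (refl , refl , refl) = refl

yWeight≡0 : ∀ {e₁ e₂ e₃} → e₁ ≡ + 0 × e₂ ≡ + 0 × e₃ ≡ + 0 → yWeight e₁ e₂ e₃ ≡ + 0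
yWeight≡0 (refl , refl , refl) = refl

pair-extras≡0 : ∀ {a b} p q A B {e₁ e₂ e₃} → IsSign e₁ → IsSign e₂ → IsSign e₃ →
  3 * 2 ^ p ≤ a → 3 * 2 ^ suc q ≤ b → ∣ A ∣ < 2 ^ p → ∣ B ∣ < 2 ^ suc q →
  + a ℤ.∣ A ℤ.+ + 2 ^ p ℤ.* xWeight e₁ e₂ e₃ → + b ℤ.∣ B ℤ.+ + 2 ^ q ℤ.* yWeight e₁ e₂ e₃ →
  e₁ ≡ + 0 × e₂ ≡ + 0 × e₃ ≡ + 0
pair-extras≡0 {a} {b} p q A B {e₁} {e₂} {e₃} s₁ s₂ s₃ 3X≤a 6Y≤b ∣A∣<X ∣B∣<2Y a∣ b∣
  with extraSigns s₁ s₂ s₃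
... | inj₁ zeros = zeros
... | inj₂ (inj₁ (1≤∣E∣ , ∣E∣≤2)) =
  ⊥-elim (n∤A+V*E A X E ∣A∣<X (ℕ.m≤m*n X (∣ E ∣) {{>-nonZero 1≤∣E∣}}) (begin
    X + X * ∣ E ∣ ≤⟨ ℕ.+-monoʳ-≤ X (ℕ.*-monoʳ-≤ X ∣E∣≤2) ⟩
    X + X * 2     ≡⟨ cong (_+_ X) (ℕ.*-comm X 2) ⟩
    3 * X         ≤⟨ 3X≤a ⟩
    a             ∎) a∣)
  where
  open ≤-Reasoning
  X : ℕ
  X = 2 ^ p
  E : ℤ
  E = xWeight e₁ e₂ e₃
... | inj₂ (inj₂ (2≤∣T∣ , ∣T∣≤4)) =
  ⊥-elim (n∤A+V*E B Y T ∣B∣<2Y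
    (subst (_≤ Y * ∣ T ∣) (ℕ.*-comm Y 2) (ℕ.*-monoʳ-≤ Y 2≤∣T∣)) (begin
    2 * Y + Y * ∣ T ∣ ≤⟨ ℕ.+-monoʳ-≤ (2 * Y) (ℕ.*-monoʳ-≤ Y ∣T∣≤4) ⟩
    2 * Y + Y * 4     ≡⟨ regroup Y ⟩
    3 * (2 * Y)       ≤⟨ 6Y≤b ⟩
    b                 ∎) b∣)
  where
  open ≤-Reasoning
  Y : ℕ
  Y = 2 ^ q
  T : ℤ
  T = yWeight e₁ e₂ e₃
  regroup : ∀ y → 2 * y + y * 4 ≡ 3 * (2 * y)
  regroup = ℕ.solve-∀

pairBlock-zeroSumFree : ∀ (m : Fin 2 → ℕ) p q → 3 * 2 ^ p ≤ m zero → 3 * 2 ^ suc q ≤ m (suc zero) →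
  ZeroSumFree m (pairBlock (m (suc zero)) p q)
pairBlock-zeroSumFree m p q 3X≤a 6Y≤b c signs divides =
  ≡0-↑ c (binary≡0⇒≡0 cA (signs ∘ (_↑ˡ _)) A≡0)
         (≡0-↑ c′ (binary≡0⇒≡0 cB (signs ∘ (p ↑ʳ_) ∘ (_↑ˡ 3)) B≡0) e≡0)
  where
  open PairBlock (m (suc zero)) p q c
  a b X Y : ℕ
  a = m zero
  b = m (suc zero)
  X = 2 ^ p
  Y = 2 ^ q
  2Y≤b : 2 * Y ≤ b
  2Y≤b = ≤-trans (ℕ.m≤n*m (2 * Y) 3) 6Y≤b
  ∣A∣<X : ∣ binary cA ∣ < X
  ∣A∣<X = ∣binary∣<2^k cA (signs ∘ (_↑ˡ _))
  ∣B∣<2Y : ∣ binary cB ∣ < 2 * Y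
  ∣B∣<2Y = ∣binary∣<2^k cB (signs ∘ (p ↑ʳ_) ∘ (_↑ˡ 3))
  a∣A+XE : + a ℤ.∣ binary cA ℤ.+ + X ℤ.* xWeight e₁ e₂ e₃
  a∣A+XE = subst (+ a ℤ.∣_) combination-first (divides zero)
  b∣B+YT : + b ℤ.∣ binary cB ℤ.+ + Y ℤ.* yWeight e₁ e₂ e₃
  b∣B+YT = ℤ.∣m+n∣n⇒∣m
    (subst (+ b ℤ.∣_) (combination-second (≤-trans (ℕ.m≤n*m Y 2) 2Y≤b)) (divides (suc zero)))
    (ℤ.∣n⇒∣m*n e₃ ℤ.∣-refl)
  extras≡0 : e₁ ≡ + 0 × e₂ ≡ + 0 × e₃ ≡ + 0
  extras≡0 = pair-extras≡0 p q (binary cA) (binary cB) (signs _) (signs _) (signs _)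
    3X≤a 6Y≤b ∣A∣<X ∣B∣<2Y a∣A+XE b∣B+YT
  e≡0 : ∀ l → c′ (suc q ↑ʳ l) ≡ + 0
  e≡0 zero             = proj₁ extras≡0
  e≡0 (suc zero)       = proj₁ (proj₂ extras≡0)
  e≡0 (suc (suc zero)) = proj₂ (proj₂ extras≡0)
  drop : ∀ x y {w} → w ≡ + 0 → x ℤ.+ y ℤ.* w ≡ x
  drop x y refl = trans (cong (ℤ._+_ x) (ℤ.*-zeroʳ y)) (ℤ.+-identityʳ x)
  A≡0 : binary cA ≡ + 0
  A≡0 = small-multiple≡0 (subst (+ a ℤ.∣_) (drop (binary cA) (+ X) (xWeight≡0 extras≡0)) a∣A+XE)
    (<-≤-trans ∣A∣<X (≤-trans (ℕ.m≤n*m X 3) 3X≤a))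
  B≡0 : binary cB ≡ + 0
  B≡0 = small-multiple≡0 (subst (+ b ℤ.∣_) (drop (binary cB) (+ Y) (yWeight≡0 extras≡0)) b∣B+YT)
    (<-≤-trans ∣B∣<2Y 2Y≤b)

3≤2n⇒2≤n : ∀ n → 3 ≤ 2 * n → 2 ≤ n
3≤2n⇒2≤n 0             ()
3≤2n⇒2≤n 1             (s≤s (s≤s ()))
3≤2n⇒2≤n (suc (suc n)) _ = s≤s (s≤s z≤n)

halve-3*2^[1+p]≤2n : ∀ {n} p → 3 * 2 ^ suc p ≤ 2 * n → 3 * 2 ^ p ≤ n
halve-3*2^[1+p]≤2n {n} p ≤2n = ℕ.*-cancelˡ-≤ 2 (subst (_≤ 2 * n) (regroup (2 ^ p)) ≤2n)
  where
  regroup : ∀ x → 3 * (2 * x) ≡ 2 * (3 * x)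
  regroup = ℕ.solve-∀

pair-sequence : ∀ (m : Fin 2 → ℕ) → FracLog≥FracLog3 (m zero) → FracLog≥FracLog3 (m (suc zero)) →
  4 ≤ m (suc zero) → ZeroSumFreeSequence m (⌊log₂ m zero ⌋ + ⌊log₂ m (suc zero) ⌋ + 1)
-- Abstracting the logarithms turns frac₁ and frac₂ into 3 · 2^(p+1) ≤ 2a and 3 · 2^(q+2) ≤ 2b.
pair-sequence m frac₁ frac₂ 4≤b
  with ⌊log₂ m zero ⌋ in log₁ | ⌊log₂ m (suc zero) ⌋ | ⌊log₂⌋-mono-≤ 4≤b
... | zero  | _           | _      =
  contradiction (subst (1 ≤_) log₁ (⌊log₂⌋-mono-≤ (3≤2n⇒2≤n (m zero) frac₁))) λ ()
... | _     | zero        | ()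
... | _     | suc zero    | s≤s ()
... | suc p | suc (suc q) | _      = subst (ZeroSumFreeSequence m) (length p q)
  (pairBlock (m (suc zero)) p q ,
   pairBlock-zeroSumFree m p q (halve-3*2^[1+p]≤2n p frac₁) (halve-3*2^[1+p]≤2n (suc q) frac₂))
  where
  length : ∀ p q → p + (suc q + 3) ≡ suc p + suc (suc q) + 1
  length = ℕ.solve-∀

-- Pairing coordinates

[4≤_] : ℕ → ℕ
[4≤ x ] = if does (4 ≤? x) then 1 else 0

[4≤]-yes : ∀ {x} → 4 ≤ x → [4≤ x ] ≡ 1
[4≤]-yes {x} 4≤x = cong (if_then 1 else 0) (dec-true (4 ≤? x) 4≤x)

[4≤]-no : ∀ {x} → ¬ 4 ≤ x → [4≤ x ] ≡ 0
[4≤]-no {x} 4≰x = cong (if_then 1 else 0) (dec-false (4 ≤? x) 4≰x)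

[4≤]≤1 : ∀ x → [4≤ x ] ≤ 1
[4≤]≤1 x with 4 ≤? x
... | yes 4≤x = ℕ.≤-reflexive ([4≤]-yes 4≤x)
... | no  4≰x = subst (_≤ 1) (sym ([4≤]-no 4≰x)) z≤n

count-remove : ∀ n (m : Fin (suc n) → ℕ) j →
  count≥4 (suc n) m ≡ [4≤ m j ] + count≥4 n (m ∘ punchIn j)
count-remove n m j = ∑-remove (λ t → [4≤ m t ]) j

big-index : ∀ n (m : Fin n → ℕ) → 1 ≤ count≥4 n m → ∃ λ j → 4 ≤ m j
big-index (suc n) m 1≤count with 4 ≤? m zero
... | yes 4≤m₀ = zero , 4≤m₀
... | no  4≰m₀ =
  let j , 4≤mⱼ = big-index n (m ∘ suc)
        (subst (1 ≤_) (cong (_+ count≥4 n (m ∘ suc)) ([4≤]-no 4≰m₀)) 1≤count)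
  in suc j , 4≤mⱼ

small-index : ∀ n (m : Fin (suc n) → ℕ) → count≥4 (suc n) m ≤ n → ∃ λ j → ¬ 4 ≤ m j
small-index n m count≤n with 4 ≤? m zero
... | no 4≰m₀ = zero , 4≰m₀
small-index zero    m count≤0 | yes 4≤m₀ =
  contradiction (subst (_≤ 0) (cong (_+ 0) ([4≤]-yes 4≤m₀)) count≤0) λ ()
small-index (suc n) m count≤n | yes 4≤m₀ =
  let j , 4≰mⱼ = small-index n (m ∘ suc)
        (ℕ.≤-pred (subst (_≤ suc n) (cong (_+ count≥4 (suc n) (m ∘ suc)) ([4≤]-yes 4≤m₀)) count≤n))
  in suc j , 4≰mⱼ

removal-keeping-count : ∀ n (m : Fin (suc n) → ℕ) h → h ≤ count≥4 (suc n) m → h ≤ n →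
  ∃ λ i → h ≤ count≥4 n (m ∘ punchIn i)
removal-keeping-count n m h h≤count h≤n with suc h ≤? count≥4 (suc n) m
... | yes h<count = zero , ℕ.≤-pred (≤-trans h<count (ℕ.+-monoˡ-≤ _ ([4≤]≤1 (m zero))))
... | no  h≮count =
  let i , 4≰mᵢ = small-index n m (≤-trans (ℕ.≤-pred (≰⇒> h≮count)) h≤n)
  in i , subst (h ≤_)
       (trans (count-remove n m i) (cong (_+ count≥4 n (m ∘ punchIn i)) ([4≤]-no 4≰mᵢ))) h≤count

singles-sequence : ∀ n (m : Fin n → ℕ) → (∀ i → 1 ≤ m i) →
  ZeroSumFreeSequence m (∑ n (λ i → ⌊log₂ m i ⌋))
singles-sequence zero    m _   = (λ ()) , λ _ _ _ ()
singles-sequence (suc n) m pos = merge-zeroSumFree (single zero)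
  (powers-sequence (λ _ → m zero) (pos zero)) (singles-sequence n (m ∘ suc) (pos ∘ suc))

paired-sequence : ∀ h n (m : Fin n → ℕ) → (∀ i → 1 ≤ m i) → (∀ i → FracLog≥FracLog3 (m i)) →
  h ≤ count≥4 n m → 2 * h ≤ n → ZeroSumFreeSequence m (∑ n (λ i → ⌊log₂ m i ⌋) + h)
paired-sequence zero n m pos _ _ _ =
  subst (ZeroSumFreeSequence m) (sym (ℕ.+-identityʳ _)) (singles-sequence n m pos)
paired-sequence (suc h) 0 m _ _ _ ()
paired-sequence (suc h) 1 m _ _ _ (s≤s 2h+1≤0) =
  contradiction (≤-trans (ℕ.m≤n+m (1 * suc h) h) 2h+1≤0) λ ()
paired-sequence (suc h) (suc (suc n)) m pos frac h<count 2h+2≤n+2 =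
  subst (ZeroSumFreeSequence m) length
    (merge-zeroSumFree (pair j i) (pair-sequence _ (frac (punchIn j i)) (frac j) 4≤mⱼ)
      (paired-sequence h n (m ∘ punchIn j ∘ punchIn i) (pos ∘ punchIn j ∘ punchIn i)
        (frac ∘ punchIn j ∘ punchIn i) h≤count₂ 2h≤n))
  where
  big : ∃ λ j → 4 ≤ m j
  big = big-index (suc (suc n)) m (≤-trans (s≤s z≤n) h<count)
  j : Fin (suc (suc n))
  j = proj₁ big
  4≤mⱼ : 4 ≤ m j
  4≤mⱼ = proj₂ big
  2h≤n : 2 * h ≤ n
  2h≤n = ℕ.≤-pred (ℕ.≤-pred (subst (_≤ suc (suc n)) (ℕ.*-suc 2 h) 2h+2≤n+2))
  h≤count₁ : h ≤ count≥4 (suc n) (m ∘ punchIn j)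
  h≤count₁ = ℕ.≤-pred (subst (suc h ≤_)
    (trans (count-remove (suc n) m j) (cong (_+ count≥4 (suc n) (m ∘ punchIn j)) ([4≤]-yes 4≤mⱼ)))
    h<count)
  removal : ∃ λ i → h ≤ count≥4 n (m ∘ punchIn j ∘ punchIn i)
  removal = removal-keeping-count n (m ∘ punchIn j) h h≤count₁ (≤-trans (ℕ.m≤n*m h 2) 2h≤n)
  i : Fin (suc n)
  i = proj₁ removal
  h≤count₂ : h ≤ count≥4 n (m ∘ punchIn j ∘ punchIn i)
  h≤count₂ = proj₂ removal
  f : Fin (suc (suc n)) → ℕ
  f t = ⌊log₂ m t ⌋
  length : f (punchIn j i) + f j + 1 + (∑ n (f ∘ punchIn j ∘ punchIn i) + h) ≡ ∑ (suc (suc n)) f + suc h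
  length = begin
    f (punchIn j i) + f j + 1 + (∑ n (f ∘ punchIn j ∘ punchIn i) + h)
      ≡⟨ regroup (f (punchIn j i)) (f j) _ h ⟩
    f j + (f (punchIn j i) + ∑ n (f ∘ punchIn j ∘ punchIn i)) + suc h
      ≡⟨ cong (λ s → f j + s + suc h) (∑-remove (f ∘ punchIn j) i) ⟨
    f j + ∑ (suc n) (f ∘ punchIn j) + suc h
      ≡⟨ cong (_+ suc h) (∑-remove f j) ⟨
    ∑ (suc (suc n)) f + suc h ∎
    where
    open ≡-Reasoning
    regroup : ∀ x y s h → x + y + 1 + (s + h) ≡ y + (x + s) + suc h
    regroup = ℕ.solve-∀

proposition4p2 : (r : ℕ) → 1 ≤ r → (m : Fin r → ℕ) → ((i : Fin r) → 1 ≤ m i) →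
    ((i : Fin r) → FracLog≥FracLog3 (m i)) →
    ⌊ r /2⌋ ≤ count≥4 r m →
    SumFracLog< r m ⌊ r /2⌋ →
    IsDpm r m (⌊log₂ ∏ r m ⌋ + 1)
proposition4p2 r _ m pos frac half≤count ∏<2^[M+1] = ℕ.m≤n+m 1 L , upper , minimal
  where
  L M : ℕ
  L = ⌊log₂ ∏ r m ⌋
  M = ∑ r (λ i → ⌊log₂ m i ⌋) + ⌊ r /2⌋
  free : ZeroSumFreeSequence m M
  free = paired-sequence ⌊ r /2⌋ r m pos frac half≤count (2*⌊n/2⌋≤n r)
  L≤M : L ≤ M
  L≤M = 2^m<2^[1+n]⇒m≤n (≤-<-trans (2^⌊log₂n⌋≤n (∏-positive r m pos))
    (subst (λ e → ∏ r m < 2 ^ e) (ℕ.+-comm M 1) ∏<2^[M+1]))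
  upper : DpmProp r m (L + 1)
  upper k L+1≤k = ∏<2^k⇒HasPMZeroSum r m pos k
    (<-≤-trans (n<2^[1+⌊log₂n⌋] (∏ r m)) (ℕ.^-monoʳ-≤ 2 (subst (_≤ k) (ℕ.+-comm L 1) L+1≤k)))
  minimal : ∀ ℓ → 1 ≤ ℓ → DpmProp r m ℓ → L + 1 ≤ ℓ
  minimal ℓ _ Dℓ = ℕ.≮⇒≥ λ ℓ<L+1 →
    zeroSumFree⇒¬HasPMZeroSum m pos (proj₁ free) (proj₂ free)
      (Dℓ M (≤-trans (ℕ.≤-pred (subst (ℓ <_) (ℕ.+-comm L 1) ℓ<L+1)) L≤M)
        (reduce m pos ∘ proj₁ free))
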